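{- Let $G=(V,E)$ be an unweighted graph with no vertex of degree $1$, let $s,t\in V$, and let $S\subseteq V$ be a minimum $s,t$-cut in $G$ that is $\alpha$-unfriendly for some $\alpha\le 1/6$. Then exactly one vertex of $G$ has friendliness ratio (with respect to $S$) less than $1/6$, and this vertex is either $s$ or $t$.
   Context: Graphs are undirected, unweighted and simple. $\mathrm{cut}_G(S)$ is the number of edges with exactly one endpoint in $S$; a minimum $s,t$-cut is $S$ with $s\in S\subseteq V\setminus\{t\}$ minimizing $\mathrm{cut}_G(S)$. For $v\in V$, $c_v(S)$ is the number of edges incident to $v$ crossing $S$, and the friendliness ratio of $v$ is $1-c_v(S)/\deg(v)$. $S$ is $\alpha$-friendly if every $v\in V$ has friendliness ratio at least $\alpha$, and $\alpha$-unfriendly otherwise.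
   Formalization: The parameter α ranges over the rationals. -}

module Defs where

open import Data.Nat using (ℕ; zero; suc; _≤_)
open import Data.Bool using (Bool; true; false; if_then_else_; _xor_; _∧_; not)
open import Data.Fin using (Fin)
open import Data.Fin.Subset using (Subset; _∈_; _∉_)
open import Data.List using (map; allFin)
open import Data.Nat.ListAction using (sum)
open import Data.Vec using (lookup)
open import Data.Integer using (+_)
open import Data.Rational using (ℚ; 1ℚ; _-_; _/_; _<_)
open import Data.Product using (∃; _×_)
open import Relation.Binary.PropositionalEquality using (_≡_; _≢_)

record Graph (n : ℕ) : Set where
  field
    adj    : Fin n → Fin n → Bool
    sym    : ∀ u v → adj u v ≡ adj v u
    irrefl : ∀ v → adj v v ≡ false
open Graph public

sumFin : ∀ {n} → (Fin n → ℕ) → ℕ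
sumFin {n} f = sum (map f (allFin n))

count : ∀ {n} → (Fin n → Bool) → ℕ
count p = sumFin (λ u → if p u then 1 else 0)

deg : ∀ {n} → Graph n → Fin n → ℕ
deg G v = count (λ u → adj G v u)

mem : ∀ {n} → Subset n → Fin n → Bool
mem S v = lookup S v

-- cut_G(S): number of edges with exactly one endpoint in S
-- (each such edge is counted once, as the ordered pair (u , w) with u ∈ S, w ∉ S)
cut : ∀ {n} → Graph n → Subset n → ℕ
cut G S = sumFin (λ u → count (λ w → mem S u ∧ not (mem S w) ∧ adj G u w))

cv : ∀ {n} → Graph n → Subset n → Fin n → ℕ
cv G S v = count (λ u → adj G v u ∧ (mem S v xor mem S u))

IsSTCut : ∀ {n} → Fin n → Fin n → Subset n → Set
IsSTCut s t S = s ∈ S × t ∉ S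

IsMinSTCut : ∀ {n} → Graph n → Fin n → Fin n → Subset n → Set
IsMinSTCut G s t S = IsSTCut s t S × (∀ S′ → IsSTCut s t S′ → cut G S ≤ cut G S′)

-- friendliness ratio 1 - c_v(S)/deg(v); for an isolated vertex (deg 0)
-- we use the convention that the ratio is 1 (no edge of v crosses S).
friendliness : ∀ {n} → Graph n → Subset n → Fin n → ℚ
friendliness G S v with deg G v
... | zero  = 1ℚ
... | suc d = 1ℚ - ((+ cv G S v) / suc d)

AlphaUnfriendly : ∀ {n} → Graph n → Subset n → ℚ → Set
AlphaUnfriendly G S α = ∃ λ v → friendliness G S v < α

oneSixth : ℚ
oneSixth = + 1 / 6

-- Moving a vertex v ∉ {s, t} to the other side of S is again an s,t-cut and
-- turns the c_v(S) crossing edges at v into the deg v − c_v(S) others, so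
-- minimality gives 2 c_v(S) ≤ deg v: only s and t can have ratio below 1/6.
-- If both had, then 5 deg < 6 c at both. Comparing with the cuts {s} and
-- V ∖ {t} bounds cut(S) by deg s and by deg t, while c_s + c_t ≤ cut(S) + 1
-- (only the edge st is counted twice); together 2 (deg s + deg t) < 6. But an
-- unfriendly vertex has positive degree, hence degree at least 2.
module Submission where

open import Defs
open import Data.Nat using (ℕ)
open import Data.Fin using (Fin)
open import Data.Fin.Subset using (Subset)
open import Data.Rational using (ℚ; _≤_; _<_)
open import Data.Product using (∃; _×_)
open import Data.Sum using (_⊎_)
open import Relation.Binary.PropositionalEquality using (_≡_; _≢_)

open import Data.Bool using (Bool; true; false; if_then_else_; _xor_; _∧_; not)
open import Data.Empty using (⊥; ⊥-elim)
open import Data.Fin using (zero; suc; punchIn; punchOut)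
open import Data.Fin.Properties using (_≟_; punchInᵢ≢i; punchIn-punchOut)
open import Data.Fin.Subset using (_∈_; _∉_; ⁅_⁆; ∁)
open import Data.Fin.Subset.Properties using (x∈⁅x⁆; x≢y⇒x∉⁅y⁆; x∉p⇒x∈∁p; x∈p⇒x∉∁p)
open import Data.Integer as ℤ using (+_)
import Data.Integer.Properties as ℤ
open import Data.List using (tabulate)
import Data.List.Properties as List
import Data.Nat.ListAction as List
open import Data.Nat as ℕ using (zero; suc; _+_; _*_; z≤n; s≤s)
import Data.Nat.Properties as ℕ
open import Data.Product using (_,_; proj₁; proj₂)
open import Data.Rational as ℚ using (1ℚ; _-_; _/_; toℚᵘ)
import Data.Rational.Properties as ℚ
open import Data.Rational.Unnormalised as ℚᵘ using (mkℚᵘ; *<*)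
import Data.Rational.Unnormalised.Properties as ℚᵘ
open import Data.Sum using (inj₁; inj₂)
open import Data.Vec using (_[_]%=_)
import Data.Vec.Properties as Vec
open import Function using (_∘_)
open import Relation.Binary.PropositionalEquality as ≡ using (refl; cong; cong₂; trans; subst₂)
open import Relation.Nullary using (¬_; yes; no)
open import Algebra.Properties.CommutativeMonoid.Sum ℕ.+-0-commutativeMonoid
  using (sum; sum-syntax; sum-cong-≗; sum-remove; ∑-distrib-+; sum-replicate-zero)

indicator : Bool → ℕ
indicator b = if b then 1 else 0

indicator≤1 : ∀ b → indicator b ℕ.≤ 1
indicator≤1 true  = ℕ.≤-refl
indicator≤1 false = z≤n

sumFin≡sum : ∀ {n} (f : Fin n → ℕ) → sumFin f ≡ sum f
sumFin≡sum f = trans (cong List.sum (List.map-tabulate (λ i → i) f)) (sum-tabulate f)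
  where
  sum-tabulate : ∀ {n} (f : Fin n → ℕ) → List.sum (tabulate f) ≡ sum f
  sum-tabulate {zero}  f = refl
  sum-tabulate {suc n} f = cong (λ s → f zero + s) (sum-tabulate (f ∘ suc))

count≡sum : ∀ {n} (p : Fin n → Bool) → count p ≡ sum (indicator ∘ p)
count≡sum p = sumFin≡sum (indicator ∘ p)

sum-zero : ∀ {n} {f : Fin n → ℕ} → (∀ i → f i ≡ 0) → sum f ≡ 0
sum-zero {n} f≡0 = trans (sum-cong-≗ f≡0) (sum-replicate-zero n)

sum-mono-≤ : ∀ {n} {f g : Fin n → ℕ} → (∀ i → f i ℕ.≤ g i) → sum f ℕ.≤ sum g
sum-mono-≤ {zero}  f≤g = z≤n
sum-mono-≤ {suc n} f≤g = ℕ.+-mono-≤ (f≤g zero) (sum-mono-≤ (f≤g ∘ suc))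

term≤sum : ∀ {n} (f : Fin n → ℕ) i → f i ℕ.≤ sum f
term≤sum f zero    = ℕ.m≤m+n (f zero) _
term≤sum f (suc i) = ℕ.≤-trans (term≤sum (f ∘ suc) i) (ℕ.m≤n+m _ (f zero))

∑∑-split-at : ∀ {n} (c : Fin (suc n) → Fin (suc n) → ℕ) v →
              ∑[ u < suc n ] ∑[ w < suc n ] c u w + c v v ≡
              ∑[ u < suc n ] c u v + ∑[ w < suc n ] c v w + ∑[ i < n ] ∑[ j < n ] c (punchIn v i) (punchIn v j)
∑∑-split-at {n} c v = begin
  sum (λ u → sum (c u)) + c v v
    ≡⟨ cong (_+ c v v) (sum-cong-≗ (λ u → sum-remove {i = v} (c u))) ⟩
  sum (λ u → c u v + row u) + c v v
    ≡⟨ cong (_+ c v v) (∑-distrib-+ (λ u → c u v) row) ⟩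
  sum (λ u → c u v) + sum row + c v v
    ≡⟨ cong (λ x → sum (λ u → c u v) + x + c v v) (sum-remove {i = v} row) ⟩
  sum (λ u → c u v) + (row v + rest) + c v v
    ≡⟨ regroup (sum (λ u → c u v)) (row v) rest (c v v) ⟩
  sum (λ u → c u v) + (c v v + row v) + rest
    ≡⟨ cong (λ x → sum (λ u → c u v) + x + rest) (sum-remove {i = v} (c v)) ⟨
  sum (λ u → c u v) + sum (c v) + rest ∎
  where
  open ≡.≡-Reasoning
  open import Data.Nat.Tactic.RingSolver
  regroup : ∀ a b r d → a + (b + r) + d ≡ a + (d + b) + r
  regroup = solve-∀
  row : Fin (suc n) → ℕ
  row u = ∑[ j < n ] c u (punchIn v j)
  rest : ℕ
  rest = ∑[ i < n ] row (punchIn v i)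

∈⇒mem≡true : ∀ {n x} {S : Subset n} → x ∈ S → mem S x ≡ true
∈⇒mem≡true = Vec.[]=⇒lookup

∉⇒mem≡false : ∀ {n x} {S : Subset n} → x ∉ S → mem S x ≡ false
∉⇒mem≡false {x = x} {S} x∉S with mem S x in eq
... | true  = ⊥-elim (x∉S (Vec.lookup⇒[]= x S eq))
... | false = refl

∈-resp-mem : ∀ {n x} {S S′ : Subset n} → mem S x ≡ mem S′ x → x ∈ S → x ∈ S′
∈-resp-mem {x = x} {S′ = S′} eq x∈S = Vec.lookup⇒[]= x S′ (trans (≡.sym eq) (∈⇒mem≡true x∈S))

IsSTCut⇒≢ : ∀ {n} {s t : Fin n} {S} → IsSTCut s t S → s ≢ t
IsSTCut⇒≢ (s∈S , t∉S) refl = t∉S s∈S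

IsSTCut-flip : ∀ {n} {s t v : Fin n} {S} → v ≢ s → v ≢ t → IsSTCut s t S → IsSTCut s t (S [ v ]%= not)
IsSTCut-flip {s = s} {t} {v} {S} v≢s v≢t (s∈S , t∉S) =
  ∈-resp-mem (≡.sym (Vec.lookup∘updateAt′ s v (v≢s ∘ ≡.sym) S)) s∈S ,
  t∉S ∘ ∈-resp-mem (Vec.lookup∘updateAt′ t v (v≢t ∘ ≡.sym) S)

toℚᵘ-1-c/d : ∀ c d → toℚᵘ (1ℚ - + c / suc d) ℚᵘ.≃ ℚᵘ.1ℚᵘ ℚᵘ.- mkℚᵘ (+ c) d
toℚᵘ-1-c/d c d = ℚᵘ.≃-trans (ℚ.toℚᵘ-homo-+ 1ℚ (ℚ.- (+ c / suc d)))
  (ℚᵘ.+-congʳ ℚᵘ.1ℚᵘ (ℚᵘ.≃-trans (ℚ.toℚᵘ-homo‿- (+ c / suc d))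
                                  (ℚᵘ.-‿cong (ℚ.toℚᵘ-fromℚᵘ (mkℚᵘ (+ c) d)))))

1-c/d<⅙⇒5d<6c : ∀ c d → 1ℚ - + c / suc d < oneSixth → 5 * suc d ℕ.< 6 * c
1-c/d<⅙⇒5d<6c c d h with ℚᵘ.<-respˡ-≃ (toℚᵘ-1-c/d c d) (ℚ.toℚᵘ-mono-< h)
... | *<* lt = ℕ.+-cancelˡ-< (suc d) _ _ (ℤ.drop‿+<+ (subst₂ ℤ._<_ lhs rhs (ℤ.+-monoˡ-< (+ 6 ℤ.* + c) lt)))
  where
  open import Data.Integer.Tactic.RingSolver
  cancel-6b : ∀ a b → (+ 1 ℤ.* a ℤ.+ ℤ.- b ℤ.* + 1) ℤ.* + 6 ℤ.+ + 6 ℤ.* b ≡ + 6 ℤ.* a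
  cancel-6b = solve-∀
  lhs : (+ 1 ℤ.* + suc d ℤ.+ ℤ.- + c ℤ.* + 1) ℤ.* + 6 ℤ.+ + 6 ℤ.* + c ≡ + (6 * suc d)
  lhs = cancel-6b (+ suc d) (+ c)
  rhs : + 1 ℤ.* + (1 * suc d) ℤ.+ + 6 ℤ.* + c ≡ + (suc d + 6 * c)
  rhs = trans (cong₂ ℤ._+_ (ℤ.*-identityˡ (+ (1 * suc d))) (≡.sym (ℤ.pos-* 6 c)))
              (trans (cong (λ m → + m ℤ.+ + (6 * c)) (ℕ.*-identityˡ (suc d))) (≡.sym (ℤ.pos-+ (suc d) (6 * c))))

friendliness<⅙⇒5deg<6cv : ∀ {n} (G : Graph n) S v → friendliness G S v < oneSixth → 5 * deg G v ℕ.< 6 * cv G S v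
friendliness<⅙⇒5deg<6cv G S v h with deg G v
... | zero  = ⊥-elim (1ℚ≮⅙ h)
  where
  1ℚ≮⅙ : ¬ 1ℚ < oneSixth
  1ℚ≮⅙ (ℚ.*<* (ℤ.+<+ (s≤s ())))
... | suc d = 1-c/d<⅙⇒5d<6c (cv G S v) d h

c+c≤d⇒5d≮6c : ∀ {c d} → c + c ℕ.≤ d → ¬ 5 * d ℕ.< 6 * c
c+c≤d⇒5d≮6c {c} {d} c+c≤d = ℕ.≤⇒≯ (begin
  6 * c        ≡⟨ six-c c ⟩
  3 * (c + c)  ≤⟨ ℕ.*-monoʳ-≤ 3 c+c≤d ⟩
  3 * d        ≤⟨ ℕ.*-monoˡ-≤ d {3} {5} (s≤s (s≤s (s≤s z≤n))) ⟩
  5 * d        ∎)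
  where
  open ℕ.≤-Reasoning
  open import Data.Nat.Tactic.RingSolver
  six-c : ∀ c → 6 * c ≡ 3 * (c + c)
  six-c = solve-∀

5d<6c⇒2≤d : ∀ {c d} → d ≢ 1 → c ℕ.≤ d → 5 * d ℕ.< 6 * c → 2 ℕ.≤ d
5d<6c⇒2≤d {d = zero}          _   z≤n ()
5d<6c⇒2≤d {d = suc zero}      d≢1 _   _ = ⊥-elim (d≢1 refl)
5d<6c⇒2≤d {d = suc (suc _)}   _   _   _ = s≤s (s≤s z≤n)

5d<6c-pair-impossible : ∀ {ds dt cs ct l} → 2 ℕ.≤ ds → 2 ℕ.≤ dt → l ℕ.≤ ds → l ℕ.≤ dt → cs + ct ℕ.≤ l + 1 →
                        5 * ds ℕ.< 6 * cs → 5 * dt ℕ.< 6 * ct → ⊥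
5d<6c-pair-impossible {suc (suc a)} {suc (suc b)} {cs} {ct} {l} (s≤s (s≤s _)) (s≤s (s≤s _)) l≤ds l≤dt cs+ct≤l+1 hs ht =
  ℕ.m+1+n≰m (3 * (ds + dt) + 6) (begin
    3 * (ds + dt) + 6 + suc (3 + 2 * a + 2 * b)  ≡⟨ regroup a b ⟩
    suc (5 * ds) + suc (5 * dt)                  ≤⟨ ℕ.+-mono-≤ hs ht ⟩
    6 * cs + 6 * ct                              ≡⟨ ℕ.*-distribˡ-+ 6 cs ct ⟨
    6 * (cs + ct)                                ≤⟨ ℕ.*-monoʳ-≤ 6 cs+ct≤l+1 ⟩
    6 * (l + 1)                                  ≡⟨ six-l l ⟩
    3 * (l + l) + 6                              ≤⟨ ℕ.+-monoˡ-≤ 6 (ℕ.*-monoʳ-≤ 3 (ℕ.+-mono-≤ l≤ds l≤dt)) ⟩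
    3 * (ds + dt) + 6                            ∎)
  where
  open ℕ.≤-Reasoning
  open import Data.Nat.Tactic.RingSolver
  ds = suc (suc a)
  dt = suc (suc b)
  regroup : ∀ a b → 3 * ((2 + a) + (2 + b)) + 6 + (1 + (3 + 2 * a + 2 * b)) ≡ (1 + 5 * (2 + a)) + (1 + 5 * (2 + b))
  regroup = solve-∀
  six-l : ∀ l → 6 * (l + 1) ≡ 3 * (l + l) + 6
  six-l = solve-∀

module _ {m : ℕ} (G : Graph (suc m)) where

  private
    n = suc m

  crossing : Subset n → Fin n → Fin n → ℕ
  crossing S u w = indicator (mem S u ∧ not (mem S w) ∧ adj G u w)

  crossesAt : Subset n → Fin n → Fin n → Bool
  crossesAt S v u = adj G v u ∧ (mem S v xor mem S u)

  cutAvoiding : Subset n → Fin n → ℕ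
  cutAvoiding S v = ∑[ i < m ] ∑[ j < m ] crossing S (punchIn v i) (punchIn v j)

  cut≡∑∑crossing : ∀ S → cut G S ≡ ∑[ u < n ] ∑[ w < n ] crossing S u w
  cut≡∑∑crossing S = trans (sumFin≡sum (λ u → sumFin (crossing S u))) (sum-cong-≗ (λ u → sumFin≡sum (crossing S u)))

  crossing-diagonal : ∀ S v → crossing S v v ≡ 0
  crossing-diagonal S v with mem S v
  ... | true  = refl
  ... | false = refl

  crossesAt≡crossing+crossing : ∀ S v u → indicator (crossesAt S v u) ≡ crossing S u v + crossing S v u
  crossesAt≡crossing+crossing S v u rewrite sym G u v with adj G v u | mem S v | mem S u
  ... | false | true  | true  = refl
  ... | false | true  | false = refl
  ... | false | false | true  = refl
  ... | false | false | false = refl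
  ... | true  | true  | true  = refl
  ... | true  | true  | false = refl
  ... | true  | false | true  = refl
  ... | true  | false | false = refl

  cv≡∑crossing : ∀ S v → cv G S v ≡ ∑[ u < n ] crossing S u v + ∑[ w < n ] crossing S v w
  cv≡∑crossing S v = begin
    cv G S v                                         ≡⟨ count≡sum (crossesAt S v) ⟩
    sum (indicator ∘ crossesAt S v)                  ≡⟨ sum-cong-≗ (crossesAt≡crossing+crossing S v) ⟩
    sum (λ u → crossing S u v + crossing S v u)      ≡⟨ ∑-distrib-+ (λ u → crossing S u v) (crossing S v) ⟩
    sum (λ u → crossing S u v) + sum (crossing S v)  ∎
    where open ≡.≡-Reasoning

  cut-split : ∀ S v → cut G S ≡ cv G S v + cutAvoiding S v
  cut-split S v = begin
    cut G S                                          ≡⟨ ℕ.+-identityʳ _ ⟨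
    cut G S + 0                                      ≡⟨ cong (λ x → cut G S + x) (crossing-diagonal S v) ⟨
    cut G S + crossing S v v                         ≡⟨ cong (_+ crossing S v v) (cut≡∑∑crossing S) ⟩
    sum (λ u → sum (crossing S u)) + crossing S v v  ≡⟨ ∑∑-split-at (crossing S) v ⟩
    sum (λ u → crossing S u v) + sum (crossing S v) + cutAvoiding S v
                                                     ≡⟨ cong (_+ cutAvoiding S v) (cv≡∑crossing S v) ⟨
    cv G S v + cutAvoiding S v                       ∎
    where open ≡.≡-Reasoning

  cutAvoiding-cong : ∀ S S′ v → (∀ u → u ≢ v → mem S u ≡ mem S′ u) → cutAvoiding S v ≡ cutAvoiding S′ v
  cutAvoiding-cong S S′ v S≐S′ = sum-cong-≗ (λ i → sum-cong-≗ (λ j →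
    cong₂ (λ a b → indicator (a ∧ not b ∧ adj G (punchIn v i) (punchIn v j)))
          (S≐S′ (punchIn v i) (punchInᵢ≢i v i)) (S≐S′ (punchIn v j) (punchInᵢ≢i v j))))

  cv-flip : ∀ S v → cv G (S [ v ]%= not) v + cv G S v ≡ deg G v
  cv-flip S v = begin
    cv G S′ v + cv G S v
      ≡⟨ cong₂ _+_ (count≡sum (crossesAt S′ v)) (count≡sum (crossesAt S v)) ⟩
    sum (indicator ∘ crossesAt S′ v) + sum (indicator ∘ crossesAt S v)
      ≡⟨ ∑-distrib-+ (indicator ∘ crossesAt S′ v) (indicator ∘ crossesAt S v) ⟨
    sum (λ u → indicator (crossesAt S′ v u) + indicator (crossesAt S v u))
      ≡⟨ sum-cong-≗ each-edge-crosses-once ⟩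
    sum (indicator ∘ adj G v)
      ≡⟨ count≡sum (adj G v) ⟨
    deg G v ∎
    where
    open ≡.≡-Reasoning
    S′ = S [ v ]%= not
    each-edge-crosses-once : ∀ u → indicator (crossesAt S′ v u) + indicator (crossesAt S v u) ≡ indicator (adj G v u)
    each-edge-crosses-once u with u ≟ v
    ... | yes refl rewrite irrefl G v = refl
    ... | no u≢v rewrite Vec.lookup∘updateAt v {not} S | Vec.lookup∘updateAt′ u v {not} u≢v S
      with adj G v u | mem S v | mem S u
    ... | false | _     | _     = refl
    ... | true  | true  | true  = refl
    ... | true  | true  | false = refl
    ... | true  | false | true  = refl
    ... | true  | false | false = refl

  cv≤deg : ∀ S v → cv G S v ℕ.≤ deg G v
  cv≤deg S v = ℕ.≤-trans (ℕ.m≤n+m (cv G S v) (cv G (S [ v ]%= not) v)) (ℕ.≤-reflexive (cv-flip S v))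

  Isolates : Subset n → Fin n → Set
  Isolates S v = ∀ u → u ≢ v → mem S u ≡ not (mem S v)

  ⁅⁆-isolates : ∀ v → Isolates ⁅ v ⁆ v
  ⁅⁆-isolates v u u≢v rewrite ∈⇒mem≡true (x∈⁅x⁆ v) = ∉⇒mem≡false (x≢y⇒x∉⁅y⁆ u≢v)

  ∁-isolates : ∀ S v → Isolates S v → Isolates (∁ S) v
  ∁-isolates S v iso u u≢v rewrite Vec.lookup-map u not S | Vec.lookup-map v not S = cong not (iso u u≢v)

  cut-isolating : ∀ S v → Isolates S v → cut G S ≡ deg G v
  cut-isolating S v iso = begin
    cut G S                     ≡⟨ cut-split S v ⟩
    cv G S v + cutAvoiding S v  ≡⟨ cong₂ _+_ cv≡deg cutAvoiding≡0 ⟩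
    deg G v + 0                 ≡⟨ ℕ.+-identityʳ (deg G v) ⟩
    deg G v                     ∎
    where
    open ≡.≡-Reasoning
    every-edge-crosses : ∀ u → indicator (crossesAt S v u) ≡ indicator (adj G v u)
    every-edge-crosses u with u ≟ v
    ... | yes refl rewrite irrefl G v = refl
    ... | no u≢v rewrite iso u u≢v with adj G v u | mem S v
    ... | false | _     = refl
    ... | true  | true  = refl
    ... | true  | false = refl
    cv≡deg : cv G S v ≡ deg G v
    cv≡deg = trans (count≡sum (crossesAt S v)) (trans (sum-cong-≗ every-edge-crosses) (≡.sym (count≡sum (adj G v))))
    no-other-edge-crosses : ∀ u w → u ≢ v → w ≢ v → crossing S u w ≡ 0
    no-other-edge-crosses u w u≢v w≢v rewrite iso u u≢v | iso w w≢v with mem S v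
    ... | true  = refl
    ... | false = refl
    cutAvoiding≡0 : cutAvoiding S v ≡ 0
    cutAvoiding≡0 = sum-zero (λ i → sum-zero (λ j →
      no-other-edge-crosses (punchIn v i) (punchIn v j) (punchInᵢ≢i v i) (punchInᵢ≢i v j)))

  cv≤cutAvoiding+1 : ∀ S s t → mem S t ≡ false → s ≢ t → cv G S t ℕ.≤ cutAvoiding S s + 1
  cv≤cutAvoiding+1 S s t t∉S s≢t = begin
    cv G S t
      ≡⟨ cv≡∑crossing S t ⟩
    sum (λ u → crossing S u t) + sum (crossing S t)
      ≡⟨ cong (λ x → sum (λ u → crossing S u t) + x) (sum-zero nothing-leaves-t) ⟩
    sum (λ u → crossing S u t) + 0
      ≡⟨ ℕ.+-identityʳ _ ⟩
    sum (λ u → crossing S u t)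
      ≡⟨ sum-remove {i = s} (λ u → crossing S u t) ⟩
    crossing S s t + sum (λ i → crossing S (punchIn s i) t)
      ≡⟨ cong (λ w → crossing S s t + sum (λ i → crossing S (punchIn s i) w)) (punchIn-punchOut s≢t) ⟨
    crossing S s t + sum (λ i → crossing S (punchIn s i) (punchIn s t′))
      ≤⟨ ℕ.+-mono-≤ (indicator≤1 _) (sum-mono-≤ (λ i → term≤sum (crossing S (punchIn s i) ∘ punchIn s) t′)) ⟩
    1 + cutAvoiding S s
      ≡⟨ ℕ.+-comm 1 (cutAvoiding S s) ⟩
    cutAvoiding S s + 1 ∎
    where
    open ℕ.≤-Reasoning
    nothing-leaves-t : ∀ u → crossing S t u ≡ 0
    nothing-leaves-t u rewrite t∉S = refl
    t′ = punchOut s≢t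

  module _ {s t S} (min : IsMinSTCut G s t S) where

    private
      s≢t = IsSTCut⇒≢ (proj₁ min)
      t∉S = ∉⇒mem≡false (proj₂ (proj₁ min))

    minCut≤deg-source : cut G S ℕ.≤ deg G s
    minCut≤deg-source = ℕ.≤-trans (proj₂ min ⁅ s ⁆ (x∈⁅x⁆ s , x≢y⇒x∉⁅y⁆ (s≢t ∘ ≡.sym)))
                                  (ℕ.≤-reflexive (cut-isolating ⁅ s ⁆ s (⁅⁆-isolates s)))

    minCut≤deg-sink : cut G S ℕ.≤ deg G t
    minCut≤deg-sink = ℕ.≤-trans (proj₂ min (∁ ⁅ t ⁆) (x∉p⇒x∈∁p (x≢y⇒x∉⁅y⁆ s≢t) , x∈p⇒x∉∁p (x∈⁅x⁆ t)))
                                (ℕ.≤-reflexive (cut-isolating (∁ ⁅ t ⁆) t (∁-isolates ⁅ t ⁆ t (⁅⁆-isolates t))))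

    cv+cv≤minCut+1 : cv G S s + cv G S t ℕ.≤ cut G S + 1
    cv+cv≤minCut+1 = begin
      cv G S s + cv G S t                ≤⟨ ℕ.+-monoʳ-≤ (cv G S s) (cv≤cutAvoiding+1 S s t t∉S s≢t) ⟩
      cv G S s + (cutAvoiding S s + 1)   ≡⟨ ℕ.+-assoc (cv G S s) (cutAvoiding S s) 1 ⟨
      cv G S s + cutAvoiding S s + 1     ≡⟨ cong (_+ 1) (cut-split S s) ⟨
      cut G S + 1                        ∎
      where open ℕ.≤-Reasoning

    interior-cv+cv≤deg : ∀ {v} → v ≢ s → v ≢ t → cv G S v + cv G S v ℕ.≤ deg G v
    interior-cv+cv≤deg {v} v≢s v≢t = begin
      cv G S v + cv G S v   ≤⟨ ℕ.+-monoˡ-≤ (cv G S v) cv≤cv-flipped ⟩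
      cv G S′ v + cv G S v  ≡⟨ cv-flip S v ⟩
      deg G v               ∎
      where
      open ℕ.≤-Reasoning
      S′ = S [ v ]%= not
      S′≐S : ∀ u → u ≢ v → mem S′ u ≡ mem S u
      S′≐S u u≢v = Vec.lookup∘updateAt′ u v u≢v S
      cut≤cut-flipped : cv G S v + cutAvoiding S v ℕ.≤ cv G S′ v + cutAvoiding S v
      cut≤cut-flipped = begin
        cv G S v + cutAvoiding S v    ≡⟨ cut-split S v ⟨
        cut G S                       ≤⟨ proj₂ min S′ (IsSTCut-flip v≢s v≢t (proj₁ min)) ⟩
        cut G S′                      ≡⟨ cut-split S′ v ⟩
        cv G S′ v + cutAvoiding S′ v  ≡⟨ cong (λ x → cv G S′ v + x) (cutAvoiding-cong S′ S v S′≐S) ⟩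
        cv G S′ v + cutAvoiding S v   ∎
      cv≤cv-flipped : cv G S v ℕ.≤ cv G S′ v
      cv≤cv-flipped = ℕ.+-cancelʳ-≤ (cutAvoiding S v) _ _ cut≤cut-flipped

    unfriendly⇒endpoint : ∀ v → friendliness G S v < oneSixth → v ≡ s ⊎ v ≡ t
    unfriendly⇒endpoint v v<⅙ with v ≟ s | v ≟ t
    ... | yes v≡s | _       = inj₁ v≡s
    ... | no _    | yes v≡t = inj₂ v≡t
    ... | no v≢s  | no v≢t  =
      ⊥-elim (c+c≤d⇒5d≮6c {cv G S v} (interior-cv+cv≤deg v≢s v≢t) (friendliness<⅙⇒5deg<6cv G S v v<⅙))

    module _ (deg≢1 : ∀ v → deg G v ≢ 1) where

      endpoints-not-both-unfriendly : friendliness G S s < oneSixth → friendliness G S t < oneSixth → ⊥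
      endpoints-not-both-unfriendly s<⅙ t<⅙ =
        5d<6c-pair-impossible {cs = cv G S s} {cv G S t}
                              (5d<6c⇒2≤d (deg≢1 s) (cv≤deg S s) 5ds<6cs) (5d<6c⇒2≤d (deg≢1 t) (cv≤deg S t) 5dt<6ct)
                              minCut≤deg-source minCut≤deg-sink cv+cv≤minCut+1 5ds<6cs 5dt<6ct
        where
        5ds<6cs = friendliness<⅙⇒5deg<6cv G S s s<⅙
        5dt<6ct = friendliness<⅙⇒5deg<6cv G S t t<⅙

      unfriendly-unique : ∀ {v w} → friendliness G S v < oneSixth → friendliness G S w < oneSixth → w ≡ v
      unfriendly-unique {v} {w} v<⅙ w<⅙ with unfriendly⇒endpoint v v<⅙ | unfriendly⇒endpoint w w<⅙
      ... | inj₁ refl | inj₁ refl = refl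
      ... | inj₂ refl | inj₂ refl = refl
      ... | inj₁ refl | inj₂ refl = ⊥-elim (endpoints-not-both-unfriendly v<⅙ w<⅙)
      ... | inj₂ refl | inj₁ refl = ⊥-elim (endpoints-not-both-unfriendly w<⅙ v<⅙)

claim3p3 : {n : ℕ} (G : Graph n) → (∀ v → deg G v ≢ 1) →
           (s t : Fin n) (S : Subset n) → IsMinSTCut G s t S →
           (α : ℚ) → α ≤ oneSixth → AlphaUnfriendly G S α →
           ∃ λ v → friendliness G S v < oneSixth
                   × (∀ w → friendliness G S w < oneSixth → w ≡ v)
                   × (v ≡ s ⊎ v ≡ t)
claim3p3 {zero}  _ _       ()
claim3p3 {suc _} G deg≢1 s t S min α α≤⅙ (v , v<α) =
  v , v<⅙ , (λ w w<⅙ → unfriendly-unique G min deg≢1 v<⅙ w<⅙) , unfriendly⇒endpoint G min v v<⅙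
  where
  v<⅙ : friendliness G S v < oneSixth
  v<⅙ = ℚ.<-≤-trans v<α α≤⅙
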